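{- Let $\mathcal R'$ be a partial normal Helly circular-arc representation of a graph $G$ and let $\mathcal R$ be a normal Helly circular-arc representation of $G$ extending $\mathcal R'$. Let $J$ be a gap of some maximal clique $D$ of $G$, and let $\le$ be the cyclic clique ordering derived from $\mathcal R$. Then the set $S_J$ is consecutive in $\le$.
   Context: A partial representation $\mathcal R'$ of $G$ is a normal Helly circular-arc representation (closed arcs of a circle, intersecting iff adjacent; any two arcs have empty or connected intersection; pairwise intersecting families have a common point) of an induced subgraph $G'$; $\mathcal R$ extends it if $R(u)=R'(u)$ on $V(G')$. In a Helly representation $\mathcal R$, each maximal clique $C$ is assigned a distinct clique point $\mathrm{cp}(C)\in\bigcap_{v\in C}R(v)$ with $\mathrm{cp}(C)\in\mathrm{Reg}(C)$; the clique ordering derived from $\mathcal R$ is the cyclic order of the clique points around the circle. For a maximal clique $C$: $\mathrm{Pre}(C)=\{R'(v): v\in C\cap V(G')\}$, $\mathrm{Reg}^+(C)=\bigcap_{R\in\mathrm{Pre}(C)}R$, $\mathrm{Reg}^-(C)=\bigcup_{R\in\mathcal R'\setminus\mathrm{Pre}(C)}R$, $\mathrm{Reg}(C)=\mathrm{Reg}^+(C)\setminus\mathrm{Reg}^-(C)$. Gaps of $D$ are the connected components of the complement of $\mathrm{Reg}(D)$. For a gap $J$, $S_J=\{C \text{ maximal clique}: \mathrm{Reg}(C)\cap J\neq\emptyset\}$.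
   Formalization: The circle is taken as the rationals in [0,1) read cyclically, so the arcs of $\mathcal R'$ and $\mathcal R$ have rational endpoints, and the clique points and the gap J are rational. -}

module Defs where

open import Level using (0ℓ)
open import Data.Nat using (ℕ)
open import Data.Fin using (Fin)
open import Data.Fin.Subset using (Subset; _∈_; _∉_)
open import Data.Rational using (ℚ; 0ℚ; 1ℚ; _≤_; _<_)
open import Data.Product using (Σ; ∃; ∃-syntax; _×_; _,_; proj₁)
open import Data.Sum using (_⊎_)
open import Data.Empty using (⊥)
open import Data.Unit using (⊤)
open import Relation.Nullary using (¬_)
open import Relation.Binary.PropositionalEquality using (_≡_; _≢_)

-- The circle: points are rationals x with 0 ≤ x < 1 (the circle ℚ/ℤ),
-- traversed in increasing (clockwise) direction.

Point : Set
Point = Σ ℚ (λ x → 0ℚ ≤ x × x < 1ℚ)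

val : Point → ℚ
val = proj₁

_≈ₚ_ : Point → Point → Set
p ≈ₚ q = val p ≡ val q

PSet : Set₁
PSet = Point → Set

-- membership of p in the closed arc going clockwise from a to b
-- (a single point if a = b)
InSeg : Point → Point → Point → Set
InSeg a b p =
  (val a ≤ val b × val a ≤ val p × val p ≤ val b)
  ⊎ (val b < val a × (val a ≤ val p ⊎ val p ≤ val b))

data Arc : Set where
  whole : Arc
  seg   : Point → Point → Arc

_∈A_ : Point → Arc → Set
p ∈A whole     = ⊤
p ∈A seg a b   = InSeg a b p

_≈A_ : Arc → Arc → Set
A ≈A B = ∀ p → (p ∈A A → p ∈A B) × (p ∈A B → p ∈A A)

Connected : PSet → Set
Connected S = ∀ p q → S p → S q →
  (∀ r → InSeg p q r → S r) ⊎ (∀ r → InSeg q p r → S r)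

Empty : PSet → Set
Empty S = ∀ p → ¬ S p

_⊆ₚ_ : PSet → PSet → Set
S ⊆ₚ T = ∀ p → S p → T p

ComponentOf : PSet → PSet → Set₁
ComponentOf J S =
  (∃ λ p → J p) × J ⊆ₚ S × Connected J ×
  (∀ (K : PSet) → Connected K → J ⊆ₚ K → K ⊆ₚ S → K ⊆ₚ J)

Intersect : Arc → Arc → Set
Intersect A B = ∃ λ p → p ∈A A × p ∈A B

record Graph (n : ℕ) : Set₁ where
  field
    Adj   : Fin n → Fin n → Set
    sym   : ∀ {u v} → Adj u v → Adj v u
    irrefl : ∀ {u} → ¬ Adj u u
open Graph public

IsClique : ∀ {n} → Graph n → Subset n → Set
IsClique G C = ∀ u v → u ∈ C → v ∈ C → u ≢ v → Adj G u v

IsMaxClique : ∀ {n} → Graph n → Subset n → Set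
IsMaxClique G C = IsClique G C ×
  (∀ w → w ∉ C → ¬ (∀ u → u ∈ C → Adj G w u))

-- Normal Helly circular-arc representation of the induced subgraph G[V]
-- (V = Data.Fin.Subset.⊤ gives a representation of G itself);
-- the arc R v is relevant only for v ∈ V.

IsNHCARep : ∀ {n} → Graph n → Subset n → (Fin n → Arc) → Set
IsNHCARep {n} G V R =
  (∀ u v → u ∈ V → v ∈ V → u ≢ v →
     (Adj G u v → Intersect (R u) (R v)) × (Intersect (R u) (R v) → Adj G u v))
  -- normal: the intersection of two arcs is empty or connected
  × (∀ u v → u ∈ V → v ∈ V →
       Empty (λ p → p ∈A R u × p ∈A R v) ⊎ Connected (λ p → p ∈A R u × p ∈A R v))
  × (∀ (S : Subset n) → (∀ v → v ∈ S → v ∈ V) →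
       (∀ u v → u ∈ S → v ∈ S → Intersect (R u) (R v)) →
       ∃ λ p → ∀ v → v ∈ S → p ∈A R v)

Extends : ∀ {n} → Subset n → (Fin n → Arc) → (Fin n → Arc) → Set
Extends V' R' R = ∀ v → v ∈ V' → R v ≡ R' v

InPre : ∀ {n} → Subset n → (Fin n → Arc) → Subset n → Arc → Set
InPre V' R' C A = ∃ λ v → v ∈ C × v ∈ V' × A ≈A R' v

RegPlus : ∀ {n} → Subset n → (Fin n → Arc) → Subset n → PSet
RegPlus V' R' C p = ∀ v → v ∈ C → v ∈ V' → p ∈A R' v

RegMinus : ∀ {n} → Subset n → (Fin n → Arc) → Subset n → PSet
RegMinus V' R' C p = ∃ λ u → u ∈ V' × ¬ InPre V' R' C (R' u) × p ∈A R' u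

Reg : ∀ {n} → Subset n → (Fin n → Arc) → Subset n → PSet
Reg V' R' C p = RegPlus V' R' C p × ¬ RegMinus V' R' C p

InSJ : ∀ {n} → Graph n → Subset n → (Fin n → Arc) → PSet → Subset n → Set
InSJ G V' R' J C = IsMaxClique G C × (∃ λ p → Reg V' R' C p × J p)

IsCliquePoints : ∀ {n} → Graph n → Subset n → (Fin n → Arc) → (Fin n → Arc) →
                 (Subset n → Point) → Set
IsCliquePoints G V' R' R cp =
  (∀ C → IsMaxClique G C → ∀ v → v ∈ C → cp C ∈A R v)
  × (∀ C → IsMaxClique G C → Reg V' R' C (cp C))
  × (∀ C D → IsMaxClique G C → IsMaxClique G D → cp C ≈ₚ cp D → C ≡ D)

-- A set S of maximal cliques is consecutive in the cyclic clique ordering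
-- given by the clique points cp: it is empty, everything, or it is exactly
-- the set of maximal cliques whose clique points lie in some closed arc.
Consecutive : ∀ {n} → Graph n → (Subset n → Point) → (Subset n → Set) → Set
Consecutive G cp S =
  (∀ C → IsMaxClique G C → ¬ S C)
  ⊎ (∀ C → IsMaxClique G C → S C)
  ⊎ (∃[ a ] ∃[ b ] ∀ C → IsMaxClique G C →
        (S C → InSeg a b (cp C)) × (InSeg a b (cp C) → S C))

-- Points lying in the same arcs of R' are interchangeable, and a region Reg(C) consists exactly of
-- the points lying in the same arcs of R' as one of its points.  The key step is that a region lies
-- entirely inside or entirely outside the gap J: if p ∈ Reg(C) ∩ J but c ∈ Reg(C) ∖ J, maximality of
-- the component J forces both arcs between p and c to meet Reg(D), at points d₁ and d₂ interleaving
-- with p and c; then every arc of R' containing one of p, d₁ contains the other, so p ∈ Reg(D),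
-- which is impossible.  Hence C ∈ S_J iff cp(C) ∈ J.  Cutting the circle open at cp(D) ∉ J, the
-- connected set J contains the arc from its first to its last clique point, and S_J is the set of
-- cliques whose clique point lies on that arc.
--
-- Everything is constructive: membership in J is decided by a finite search, since every point of an
-- arc lies in the same arcs of R' as one of the endpoints involved or the midpoint of two of them.

module Submission where

open import Defs hiding (sym)
open import Data.Nat using (zero; suc)
open import Data.Bool using (true; false)
open import Data.Vec using ([]; _∷_)
open import Data.Fin using (Fin)
open import Data.Fin.Subset using (Subset; _∈_; ⊤)
open import Data.Fin.Subset.Properties using (_∈?_)
open import Data.Fin.Properties using (all?)
open import Data.Rational using (ℚ; 1ℚ; _≤_; _<_; _+_; _-_; -_)
open import Data.Rational.Properties as ℚ
  using (_≤?_; _<?_; _≟_; ≤-refl; ≤-trans; <-trans; <⇒≤; ≤-<-trans; <-≤-trans; <-irrefl; ≰⇒>; ≮⇒≥;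
         ≤-antisym; ≤-irrelevant; <-irrelevant; <-dense; +-monoˡ-≤; +-monoˡ-<)
open import Algebra.Properties.Group ℚ.+-0-group using (//-rightDividesˡ; //-rightDividesʳ)
open import Data.Product using (Σ; ∃; ∃₂; _×_; _,_; proj₁; proj₂)
open import Data.Sum using (_⊎_; inj₁; inj₂; [_,_]′)
import Data.Sum as Sum
import Data.Product as Prod
open import Data.Empty using (⊥-elim)
open import Data.List using (List; []; _∷_; _++_; map; filter; concatMap; cartesianProductWith; allFin)
open import Data.List.Relation.Unary.Any using (Any; here; there; any?; satisfied)
open import Data.List.Relation.Unary.All as All using ()
open import Data.List.Relation.Unary.All.Properties using (all-filter)
open import Data.List.Membership.Propositional using (lose) renaming (_∈_ to _∈ₗ_)
open import Data.List.Membership.Propositional.Properties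
  using (∈-filter⁺; ∈-filter⁻; ∈-map⁺; ∈-++⁺ˡ; ∈-++⁺ʳ; ∈-concatMap⁺; ∈-allFin; ∈-cartesianProductWith⁺)
open import Data.List.Relation.Binary.Subset.Propositional using (_⊆_)
open import Relation.Binary.Bundles using (DecTotalOrder)
open import Data.List.Extrema (DecTotalOrder.totalOrder ℚ.≤-decTotalOrder)
  using (argmin; argmax; argmin-sel; argmax-sel; argmin-all; argmax-all;
         f[argmin]≤f[⊤]; f[⊥]≤f[argmax]; f[argmin]≤f[xs]; f[xs]≤f[argmax])
open import Function.Base using (_∘_; id)
open import Function.Bundles using (_⇔_; mk⇔; Equivalence)
open import Function.Construct.Identity using (⇔-id)
open import Function.Properties.Equivalence using () renaming (sym to ⇔-sym; trans to ⇔-trans)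
open import Relation.Nullary using (¬_; Dec; yes; no)
open import Relation.Nullary.Decidable using (_×-dec_; _⊎-dec_; _→-dec_; map′)
open import Relation.Binary.PropositionalEquality using (_≡_; _≢_; refl; sym; cong₂; subst)

open Equivalence using (to; from)

_⇔-dec_ : ∀ {A B : Set} → Dec A → Dec B → Dec (A ⇔ B)
A? ⇔-dec B? = map′ (λ (f , g) → mk⇔ f g) (λ e → to e , from e) ((A? →-dec B?) ×-dec (B? →-dec A?))

≤⇒≯ : ∀ {x y} → x ≤ y → ¬ y < x
≤⇒≯ x≤y y<x = <-irrefl refl (<-≤-trans y<x x≤y)

≤∧≢⇒< : ∀ {x y} → x ≤ y → x ≢ y → x < y
≤∧≢⇒< {x} {y} x≤y x≢y with x <? y
... | yes x<y = x<y
... | no  x≮y = ⊥-elim (x≢y (≤-antisym x≤y (≮⇒≥ x≮y)))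

+-cancelʳ-≤ : ∀ c {x y} → x + c ≤ y + c → x ≤ y
+-cancelʳ-≤ c x+c≤y+c = ≮⇒≥ (λ y<x → ≤⇒≯ x+c≤y+c (+-monoˡ-< c y<x))

+-cancelʳ-< : ∀ c {x y} → x + c < y + c → x < y
+-cancelʳ-< c x+c<y+c = ≰⇒> (λ y≤x → ≤⇒≯ (+-monoˡ-≤ c y≤x) x+c<y+c)

≤⇔+-≤ : ∀ c {x y} → x ≤ y ⇔ x + c ≤ y + c
≤⇔+-≤ c = mk⇔ (+-monoˡ-≤ c) (+-cancelʳ-≤ c)

<⇔+-< : ∀ c {x y} → x < y ⇔ x + c < y + c
<⇔+-< c = mk⇔ (+-monoˡ-< c) (+-cancelʳ-< c)

Between : ℚ → ℚ → ℚ → Set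
Between α β ξ = (α ≤ β × α ≤ ξ × ξ ≤ β) ⊎ (β < α × (α ≤ ξ ⊎ ξ ≤ β))

module _ {α β ξ : ℚ} where

  between-ordered : α ≤ β → Between α β ξ ⇔ (α ≤ ξ × ξ ≤ β)
  between-ordered α≤β = mk⇔
    (λ { (inj₁ (_ , bounds)) → bounds ; (inj₂ (β<α , _)) → ⊥-elim (≤⇒≯ α≤β β<α) })
    (λ bounds → inj₁ (α≤β , bounds))

  between-wrapped : β < α → Between α β ξ ⇔ (α ≤ ξ ⊎ ξ ≤ β)
  between-wrapped β<α = mk⇔
    (λ { (inj₁ (α≤β , _)) → ⊥-elim (≤⇒≯ α≤β β<α) ; (inj₂ (_ , bounds)) → bounds })
    (λ bounds → inj₂ (β<α , bounds))

  between-ξ-min : ξ < α → ξ < β → Between α β ξ ⇔ β < α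
  between-ξ-min ξ<α ξ<β = mk⇔
    (λ { (inj₁ (_ , α≤ξ , _)) → ⊥-elim (≤⇒≯ α≤ξ ξ<α) ; (inj₂ (β<α , _)) → β<α })
    (λ β<α → inj₂ (β<α , inj₂ (<⇒≤ ξ<β)))

  between-ξ-max : α < ξ → β < ξ → Between α β ξ ⇔ β < α
  between-ξ-max α<ξ β<ξ = mk⇔
    (λ { (inj₁ (_ , _ , ξ≤β)) → ⊥-elim (≤⇒≯ ξ≤β β<ξ) ; (inj₂ (β<α , _)) → β<α })
    (λ β<α → inj₂ (β<α , inj₁ (<⇒≤ α<ξ)))

  between-β-min : β < α → β < ξ → Between α β ξ ⇔ α ≤ ξ
  between-β-min β<α β<ξ = mk⇔
    (λ { (inj₁ (α≤β , _)) → ⊥-elim (≤⇒≯ α≤β β<α)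
       ; (inj₂ (_ , inj₁ α≤ξ)) → α≤ξ
       ; (inj₂ (_ , inj₂ ξ≤β)) → ⊥-elim (≤⇒≯ ξ≤β β<ξ) })
    (λ α≤ξ → inj₂ (β<α , inj₁ α≤ξ))

  between-β-max : α < β → ξ < β → Between α β ξ ⇔ α ≤ ξ
  between-β-max α<β ξ<β = mk⇔
    (λ { (inj₁ (_ , α≤ξ , _)) → α≤ξ ; (inj₂ (β<α , _)) → ⊥-elim (≤⇒≯ (<⇒≤ α<β) β<α) })
    (λ α≤ξ → inj₁ (<⇒≤ α<β , α≤ξ , <⇒≤ ξ<β))

  between-α-min : α ≤ β → α ≤ ξ → Between α β ξ ⇔ ξ ≤ β
  between-α-min α≤β α≤ξ = ⇔-trans (between-ordered α≤β) (mk⇔ proj₂ (α≤ξ ,_))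

  between-α-max : β < α → ξ < α → Between α β ξ ⇔ ξ ≤ β
  between-α-max β<α ξ<α = ⇔-trans (between-wrapped β<α)
    (mk⇔ [ (λ α≤ξ → ⊥-elim (≤⇒≯ α≤ξ ξ<α)) , id ]′ inj₂)

module _ {f : ℚ → ℚ} (≤-f : ∀ {x y} → x ≤ y ⇔ f x ≤ f y) (<-f : ∀ {x y} → x < y ⇔ f x < f y) where

  between-embedding : ∀ {α β ξ} → Between α β ξ ⇔ Between (f α) (f β) (f ξ)
  between-embedding = mk⇔
    (Sum.map (Prod.map (to ≤-f) (Prod.map (to ≤-f) (to ≤-f)))
             (Prod.map (to <-f) (Sum.map (to ≤-f) (to ≤-f))))
    (Sum.map (Prod.map (from ≤-f) (Prod.map (from ≤-f) (from ≤-f)))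
             (Prod.map (from <-f) (Sum.map (from ≤-f) (from ≤-f))))

between-constant : ∀ {α β ε φ ξ ξ′} → (α ≤ ε ⊎ φ ≤ α) → (β ≤ ε ⊎ φ ≤ β) →
                   ε < ξ → ξ < φ → ε < ξ′ → ξ′ < φ → Between α β ξ → Between α β ξ′
between-constant {α} {β} {ε} {φ} {ξ} {ξ′} α-outside β-outside ε<ξ ξ<φ ε<ξ′ ξ′<φ =
  Sum.map (Prod.map₂ (Prod.map α≤ ≤β)) (Prod.map₂ (Sum.map α≤ ≤β))
  where
  α≤ : α ≤ ξ → α ≤ ξ′
  α≤ α≤ξ = [ (λ α≤ε → <⇒≤ (≤-<-trans α≤ε ε<ξ′)) , (λ φ≤α → ⊥-elim (≤⇒≯ (≤-trans φ≤α α≤ξ) ξ<φ)) ]′ α-outside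
  ≤β : ξ ≤ β → ξ′ ≤ β
  ≤β ξ≤β = [ (λ β≤ε → ⊥-elim (≤⇒≯ (≤-trans ξ≤β β≤ε) ε<ξ)) , (λ φ≤β → <⇒≤ (<-≤-trans ξ′<φ φ≤β)) ]′ β-outside

between? : ∀ α β ξ → Dec (Between α β ξ)
between? α β ξ = (α ≤? β ×-dec α ≤? ξ ×-dec ξ ≤? β) ⊎-dec (β <? α ×-dec (α ≤? ξ ⊎-dec ξ ≤? β))

-- Coordinates on the circle
val-injective : ∀ {p q : Point} → val p ≡ val q → p ≡ q
val-injective {v , _ , _} {.v , _ , _} refl = cong₂ (λ x y → v , x , y) (≤-irrelevant _ _) (<-irrelevant _ _)

val<1 : ∀ x → val x < 1ℚ
val<1 x = proj₂ (proj₂ x)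

val<val+1 : ∀ x y → val x < val y + 1ℚ
val<val+1 x y = <-≤-trans (val<1 x) (+-monoˡ-≤ 1ℚ (proj₁ (proj₂ y)))

-- The position of x on the circle cut open at o: a value in [val o, val o + 1).
coord : Point → Point → ℚ
coord o x with val o ≤? val x
... | yes _ = val x
... | no  _ = val x + 1ℚ

module _ (o : Point) where

  coord-self : coord o o ≡ val o
  coord-self with val o ≤? val o
  ... | yes _ = refl
  ... | no o≰o = ⊥-elim (o≰o ≤-refl)

  coord-min : ∀ x → val o ≤ coord o x
  coord-min x with val o ≤? val x
  ... | yes o≤x = o≤x
  ... | no  _   = <⇒≤ (val<val+1 o x)

  coord-min-self : ∀ x → coord o o ≤ coord o x
  coord-min-self x = subst (_≤ coord o x) (sym coord-self) (coord-min x)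

  coord-injective : ∀ x y → coord o x ≡ coord o y → x ≡ y
  coord-injective x y eq with val o ≤? val x | val o ≤? val y
  ... | yes _ | yes _ = val-injective eq
  ... | no  _ | no  _ = val-injective (≤-antisym (+-cancelʳ-≤ 1ℚ (ℚ.≤-reflexive eq))
                                                 (+-cancelʳ-≤ 1ℚ (ℚ.≤-reflexive (sym eq))))
  ... | yes _ | no  _ = ⊥-elim (<-irrefl eq (val<val+1 x y))
  ... | no  _ | yes _ = ⊥-elim (<-irrefl (sym eq) (val<val+1 y x))

  private
    below : ∀ u v → ¬ val o ≤ val u → val o ≤ val v → val u < val v
    below _ _ o≰u o≤v = <-≤-trans (≰⇒> o≰u) o≤v

  inSeg⇔between-coord : ∀ a b x → InSeg a b x ⇔ Between (coord o a) (coord o b) (coord o x)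
  inSeg⇔between-coord a b x with val o ≤? val a | val o ≤? val b | val o ≤? val x
  ... | yes _  | yes _  | yes _  = ⇔-id _
  ... | no  _  | no  _  | no  _  = between-embedding (≤⇔+-≤ 1ℚ) (<⇔+-< 1ℚ)
  ... | yes oa | yes ob | no  ox = ⇔-trans (between-ξ-min (below x a ox oa) (below x b ox ob))
                                     (⇔-sym (between-ξ-max (val<val+1 a x) (val<val+1 b x)))
  ... | yes oa | no  ob | yes ox = ⇔-trans (between-β-min (below b a ob oa) (below b x ob ox))
                                     (⇔-sym (between-β-max (val<val+1 a b) (val<val+1 x b)))
  ... | yes oa | no  ob | no  ox = ⇔-trans (between-α-max (below b a ob oa) (below x a ox oa))
                                     (⇔-trans (≤⇔+-≤ 1ℚ)
                                       (⇔-sym (between-α-min (<⇒≤ (val<val+1 a b)) (<⇒≤ (val<val+1 a x)))))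
  ... | no  oa | yes ob | yes ox = ⇔-trans (between-α-min (<⇒≤ (below a b oa ob)) (<⇒≤ (below a x oa ox)))
                                     (⇔-sym (between-α-max (val<val+1 b a) (val<val+1 x a)))
  ... | no  oa | yes ob | no  ox = ⇔-trans (between-β-max (below a b oa ob) (below x b ox ob))
                                     (⇔-trans (≤⇔+-≤ 1ℚ)
                                       (⇔-sym (between-β-min (val<val+1 b a) (val<val+1 b x))))
  ... | no  oa | no  ob | yes ox = ⇔-trans (between-ξ-max (below a x oa ox) (below b x ob ox))
                                     (⇔-trans (<⇔+-< 1ℚ)
                                       (⇔-sym (between-ξ-min (val<val+1 x a) (val<val+1 x b))))

  coord-bound : ∀ x → coord o x < val o + 1ℚ
  coord-bound x with val o ≤? val x
  ... | yes _   = val<val+1 x o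
  ... | no  o≰x = +-monoˡ-< 1ℚ (≰⇒> o≰x)

  inSeg-ordered : ∀ {a b} x → coord o a ≤ coord o b →
                  InSeg a b x ⇔ (coord o a ≤ coord o x × coord o x ≤ coord o b)
  inSeg-ordered x a≤b = ⇔-trans (inSeg⇔between-coord _ _ x) (between-ordered a≤b)

  inSeg-wrapped : ∀ {a b} x → coord o b < coord o a →
                  InSeg a b x ⇔ (coord o a ≤ coord o x ⊎ coord o x ≤ coord o b)
  inSeg-wrapped x b<a = ⇔-trans (inSeg⇔between-coord _ _ x) (between-wrapped b<a)

  inSeg-from : ∀ b x → InSeg o b x ⇔ coord o x ≤ coord o b
  inSeg-from b x = ⇔-trans (inSeg⇔between-coord o b x) (between-α-min (coord-min-self b) (coord-min-self x))

  private
    q-1<o : ∀ {q} → q < val o + 1ℚ → q - 1ℚ < val o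
    q-1<o {q} q<o+1 = subst (q - 1ℚ <_) (//-rightDividesʳ 1ℚ (val o)) (+-monoˡ-< (- 1ℚ) q<o+1)

  fromCoord : (q : ℚ) → val o ≤ q → q < val o + 1ℚ → Point
  fromCoord q o≤q q<o+1 with q <? 1ℚ
  ... | yes q<1 = q , ≤-trans (proj₁ (proj₂ o)) o≤q , q<1
  ... | no  q≮1 = q - 1ℚ , +-monoˡ-≤ (- 1ℚ) (≮⇒≥ q≮1) , <-trans (q-1<o q<o+1) (val<1 o)

  coord-fromCoord : ∀ q o≤q q<o+1 → coord o (fromCoord q o≤q q<o+1) ≡ q
  coord-fromCoord q o≤q q<o+1 with q <? 1ℚ
  ... | yes _ with val o ≤? q
  ...   | yes _   = refl
  ...   | no  o≰q = ⊥-elim (o≰q o≤q)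
  coord-fromCoord q o≤q q<o+1 | no _ with val o ≤? q - 1ℚ
  ...   | yes o≤q-1 = ⊥-elim (≤⇒≯ o≤q-1 (q-1<o q<o+1))
  ...   | no  _     = //-rightDividesˡ 1ℚ q

  point-between : ∀ {x y} → coord o x < coord o y →
                  Σ Point λ m → coord o x < coord o m × coord o m < coord o y
  point-between {x} {y} x<y with <-dense x<y
  ... | q , x<q , q<y = fromCoord q o≤q q<o+1 ,
    subst (λ c → coord o x < c × c < coord o y) (sym (coord-fromCoord q o≤q q<o+1)) (x<q , q<y)
    where
    o≤q : val o ≤ q
    o≤q = ≤-trans (coord-min x) (<⇒≤ x<q)
    q<o+1 : q < val o + 1ℚ
    q<o+1 = <-trans q<y (coord-bound y)

  -- Falls back to x when there is no room between x and y.
  midpoint : Point → Point → Point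
  midpoint x y with coord o x <? coord o y
  ... | yes x<y = proj₁ (point-between x<y)
  ... | no  _   = x

  midpoint-between : ∀ {x y} → coord o x < coord o y →
                     coord o x < coord o (midpoint x y) × coord o (midpoint x y) < coord o y
  midpoint-between {x} {y} x<y with coord o x <? coord o y
  ... | yes x<y′ = proj₂ (point-between x<y′)
  ... | no  x≮y  = ⊥-elim (x≮y x<y)

-- Arcs and connected sets
seg-start : ∀ a b → InSeg a b a
seg-start a b with val a ≤? val b
... | yes a≤b = inj₁ (a≤b , ≤-refl , a≤b)
... | no  a≰b = inj₂ (≰⇒> a≰b , inj₁ ≤-refl)

seg-end : ∀ a b → InSeg a b b
seg-end a b with val a ≤? val b
... | yes a≤b = inj₁ (a≤b , a≤b , ≤-refl)
... | no  a≰b = inj₂ (≰⇒> a≰b , inj₂ ≤-refl)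

inSeg-from-⊇ : ∀ a b x y → coord a x ≤ coord a y → InSeg a b y → ∀ r → InSeg x y r → InSeg a b r
inSeg-from-⊇ a b x y x≤y y∈ab r r∈xy = from (inSeg-from a b r)
  (≤-trans (proj₂ (to (inSeg-ordered a r x≤y) r∈xy)) (to (inSeg-from a b _) y∈ab))

arc-connected : ∀ A → Connected (_∈A A)
arc-connected whole     x y _ _ = inj₁ (λ _ _ → _)
arc-connected (seg a b) x y x∈A y∈A with coord a x ≤? coord a y
... | yes x≤y = inj₁ (inSeg-from-⊇ a b x y x≤y y∈A)
... | no  x≰y = inj₂ (inSeg-from-⊇ a b y x (<⇒≤ (≰⇒> x≰y)) x∈A)

inSeg-split : ∀ x p y r → InSeg x y r → InSeg x p r ⊎ InSeg p y r
inSeg-split x p y r r∈xy with coord x r ≤? coord x p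
... | yes r≤p = inj₁ (from (inSeg-from x p r) r≤p)
... | no  r≰p = inj₂ (from (inSeg-ordered x r (≤-trans (<⇒≤ p<r) r≤y)) (<⇒≤ p<r , r≤y))
  where
  p<r : coord x p < coord x r
  p<r = ≰⇒> r≰p
  r≤y : coord x r ≤ coord x y
  r≤y = to (inSeg-from x y r) r∈xy

subarc-from : ∀ p x y → (∀ r → InSeg x y r → InSeg p y r) ⊎ (∀ r → InSeg y x r → InSeg p x r)
subarc-from p x y with coord p x ≤? coord p y
... | yes x≤y = inj₁ (inSeg-from-⊇ p y x y x≤y (seg-end p y))
... | no  x≰y = inj₂ (inSeg-from-⊇ p x y x (<⇒≤ (≰⇒> x≰y)) (seg-end p x))

subarc-to : ∀ p x y → (∀ r → InSeg x y r → InSeg x p r) ⊎ (∀ r → InSeg y x r → InSeg y p r)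
subarc-to p x y with coord x y ≤? coord x p
... | yes y≤p = inj₁ λ r r∈xy → from (inSeg-from x p r) (≤-trans (to (inSeg-from x y r) r∈xy) y≤p)
... | no  y≰p = inj₂ λ r r∈yx → from (inSeg-wrapped x r p<y)
      ([ inj₁ , (λ r≤x → inj₂ (≤-trans r≤x (coord-min-self x p))) ]′ (to (inSeg-wrapped x r x<y) r∈yx))
  where
  p<y : coord x p < coord x y
  p<y = ≰⇒> y≰p
  x<y : coord x x < coord x y
  x<y = ≤-<-trans (coord-min-self x p) p<y

∪-connected : ∀ {A B : PSet} {p} → Connected A → Connected B → A p → B p →
              Connected (λ r → A r ⊎ B r)
∪-connected {A} {B} {p} A-conn B-conn Ap Bp = connected
  where
  Joined : Point → Point → Set
  Joined x y = (∀ r → InSeg x y r → A r ⊎ B r) ⊎ (∀ r → InSeg y x r → A r ⊎ B r)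

  mixed : ∀ x y → A x → B y → Joined x y
  mixed x y Ax By with A-conn x p Ax Ap | B-conn p y Bp By
  ... | inj₁ xp⊆A | inj₁ py⊆B =
    inj₁ λ r r∈xy → Sum.map (xp⊆A r) (py⊆B r) (inSeg-split x p y r r∈xy)
  ... | inj₁ xp⊆A | inj₂ yp⊆B =
    Sum.map (λ xy⊆xp r → inj₁ ∘ xp⊆A r ∘ xy⊆xp r) (λ yx⊆yp r → inj₂ ∘ yp⊆B r ∘ yx⊆yp r) (subarc-to p x y)
  ... | inj₂ px⊆A | inj₁ py⊆B =
    Sum.map (λ xy⊆py r → inj₂ ∘ py⊆B r ∘ xy⊆py r) (λ yx⊆px r → inj₁ ∘ px⊆A r ∘ yx⊆px r) (subarc-from p x y)
  ... | inj₂ px⊆A | inj₂ yp⊆B =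
    inj₂ λ r r∈yx → Sum.swap (Sum.map (yp⊆B r) (px⊆A r) (inSeg-split y p x r r∈yx))

  connected : Connected (λ r → A r ⊎ B r)
  connected x y (inj₁ Ax) (inj₁ Ay) = Sum.map (λ xy⊆A r → inj₁ ∘ xy⊆A r) (λ yx⊆A r → inj₁ ∘ yx⊆A r) (A-conn x y Ax Ay)
  connected x y (inj₂ Bx) (inj₂ By) = Sum.map (λ xy⊆B r → inj₂ ∘ xy⊆B r) (λ yx⊆B r → inj₂ ∘ yx⊆B r) (B-conn x y Bx By)
  connected x y (inj₁ Ax) (inj₂ By) = mixed x y Ax By
  connected x y (inj₂ Bx) (inj₁ Ay) = Sum.swap (mixed y x Ay Bx)

interleave : ∀ {p c d₁ d₂} → InSeg p c d₁ → InSeg c p d₂ → d₁ ≢ c → d₂ ≢ c → d₂ ≢ p →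
             InSeg d₁ d₂ c × InSeg d₂ d₁ p
interleave {p} {c} {d₁} {d₂} d₁∈pc d₂∈cp d₁≢c d₂≢c d₂≢p =
  from (inSeg-ordered p c (<⇒≤ d₁<d₂)) (<⇒≤ d₁<c , <⇒≤ c<d₂) ,
  from (inSeg-wrapped p p d₁<d₂) (inj₂ (coord-min-self p d₁))
  where
  d₁<c : coord p d₁ < coord p c
  d₁<c = ≤∧≢⇒< (to (inSeg-from p c d₁) d₁∈pc) (d₁≢c ∘ coord-injective p d₁ c)
  p<c : coord p p < coord p c
  p<c = ≤-<-trans (coord-min-self p d₁) d₁<c
  c≤d₂ : coord p c ≤ coord p d₂
  c≤d₂ = [ (λ c≤d₂ → c≤d₂)
         , (λ d₂≤p → ⊥-elim (d₂≢p (coord-injective p d₂ p (≤-antisym d₂≤p (coord-min-self p d₂))))) ]′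
         (to (inSeg-wrapped p d₂ p<c) d₂∈cp)
  c<d₂ : coord p c < coord p d₂
  c<d₂ = ≤∧≢⇒< c≤d₂ (λ eq → d₂≢c (sym (coord-injective p c d₂ eq)))
  d₁<d₂ : coord p d₁ < coord p d₂
  d₁<d₂ = <-trans d₁<c c<d₂

interleaved-⇔ : ∀ A {p c d₁ d₂} → InSeg p c d₁ → InSeg c p d₂ → InSeg d₁ d₂ c → InSeg d₂ d₁ p →
                p ∈A A ⇔ c ∈A A → d₁ ∈A A ⇔ d₂ ∈A A → p ∈A A ⇔ d₁ ∈A A
interleaved-⇔ A {p} {c} {d₁} {d₂} d₁∈pc d₂∈cp c∈d₁d₂ p∈d₂d₁ p~c d₁~d₂ = mk⇔
  (λ p∈A → [ (λ pc⊆A → pc⊆A d₁ d₁∈pc) , (λ cp⊆A → from d₁~d₂ (cp⊆A d₂ d₂∈cp)) ]′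
           (arc-connected A p c p∈A (to p~c p∈A)))
  (λ d₁∈A → [ (λ d₁d₂⊆A → from p~c (d₁d₂⊆A c c∈d₁d₂)) , (λ d₂d₁⊆A → d₂d₁⊆A p p∈d₂d₁) ]′
            (arc-connected A d₁ d₂ d₁∈A (to d₁~d₂ d₁∈A)))

component-absorbs : ∀ {J S K : PSet} → ComponentOf J S → Connected K → K ⊆ₚ S →
                    ∀ {p} → J p → K p → K ⊆ₚ J
component-absorbs {J} {S} {K} (_ , J⊆S , J-conn , maximal) K-conn K⊆S Jp Kp r Kr =
  maximal (λ q → J q ⊎ K q) (∪-connected J-conn K-conn Jp Kp) (λ _ → inj₁)
          (λ q → [ J⊆S q , K⊆S q ]′) r (inj₂ Kr)

connected-avoiding-⊇ : ∀ {J : PSet} {d a b} → Connected J → ¬ J d → J a → J b →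
                       coord d a ≤ coord d b → ∀ x → InSeg a b x → J x
connected-avoiding-⊇ {J} {d} {a} {b} J-conn d∉J Ja Jb a≤b with J-conn a b Ja Jb
... | inj₁ ab⊆J = ab⊆J
... | inj₂ ba⊆J with coord d a <? coord d b
...   | yes a<b = ⊥-elim (d∉J (ba⊆J d (from (inSeg-wrapped d d a<b) (inj₂ (coord-min-self d a)))))
...   | no  a≮b with coord-injective d a b (≤-antisym a≤b (≮⇒≥ a≮b))
...     | refl = ba⊆J

connected-hull : ∀ {J : PSet} {d} → (∀ x → Dec (J x)) → Connected J → ¬ J d → (L : List Point) →
                 (∀ x → x ∈ₗ L → ¬ J x) ⊎
                 ∃₂ λ a b → (∀ x → x ∈ₗ L → J x → InSeg a b x) × (∀ x → InSeg a b x → J x)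
connected-hull {J} {d} J? J-conn d∉J L with any? J? L
... | no  none  = inj₁ λ x x∈L Jx → none (lose x∈L Jx)
... | yes found = inj₂ (a , b , hull , connected-avoiding-⊇ J-conn d∉J Ja Jb a≤b)
  where
  w : Point
  w = proj₁ (satisfied found)
  Jw : J w
  Jw = proj₂ (satisfied found)
  F : List Point
  F = filter J? L
  a b : Point
  a = argmin (coord d) w F
  b = argmax (coord d) w F
  Ja : J a
  Ja = argmin-all (coord d) Jw (all-filter J? L)
  Jb : J b
  Jb = argmax-all (coord d) Jw (all-filter J? L)
  a≤b : coord d a ≤ coord d b
  a≤b = ≤-trans (f[argmin]≤f[⊤] {f = coord d} w F) (f[⊥]≤f[argmax] {f = coord d} w F)
  hull : ∀ x → x ∈ₗ L → J x → InSeg a b x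
  hull x x∈L Jx = from (inSeg-ordered d x a≤b)
    (All.lookup (f[argmin]≤f[xs] {f = coord d} w F) x∈F , All.lookup (f[xs]≤f[argmax] {f = coord d} w F) x∈F)
    where
    x∈F : x ∈ₗ F
    x∈F = ∈-filter⁺ J? x∈L Jx

-- Finite families of arcs
∈A? : ∀ x A → Dec (x ∈A A)
∈A? x whole     = yes _
∈A? x (seg a b) = between? (val a) (val b) (val x)

module Arcs {k} (V : Subset k) (A : Fin k → Arc) where

  SameArcs : Point → Point → Set
  SameArcs x y = ∀ u → u ∈ V → x ∈A A u ⇔ y ∈A A u

  sameArcs-refl : ∀ {x} → SameArcs x x
  sameArcs-refl _ _ = ⇔-id _

  sameArcs? : ∀ x y → Dec (SameArcs x y)
  sameArcs? x y = all? (λ u → u ∈? V →-dec (∈A? x (A u) ⇔-dec ∈A? y (A u)))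

  ends : Arc → List Point
  ends whole     = []
  ends (seg a b) = a ∷ b ∷ []

  endpoints : List Point
  endpoints = concatMap (ends ∘ A) (allFin k)

  endpoints-complete : ∀ u → ends (A u) ⊆ endpoints
  endpoints-complete u x∈ends = ∈-concatMap⁺ (ends ∘ A) (lose (∈-allFin u) x∈ends)

  module _ (s : Point) where

    breakpoint-gap-sameArcs : ∀ {e f r m} → (∀ w → w ∈ₗ endpoints → coord s w ≤ coord s e ⊎ coord s f ≤ coord s w) →
                   coord s e < coord s r → coord s r < coord s f →
                   coord s e < coord s m → coord s m < coord s f → SameArcs r m
    breakpoint-gap-sameArcs {e} {f} {r} {m} separated e<r r<f e<m m<f u _ = same (A u) (endpoints-complete u)
      where
      same : ∀ B → ends B ⊆ endpoints → r ∈A B ⇔ m ∈A B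
      same whole     _     = ⇔-id _
      same (seg a b) ends⊆ = ⇔-trans (inSeg⇔between-coord s a b r)
        (⇔-trans (mk⇔ (between-constant a-outside b-outside e<r r<f e<m m<f)
                      (between-constant a-outside b-outside e<m m<f e<r r<f))
                 (⇔-sym (inSeg⇔between-coord s a b m)))
        where
        a-outside : coord s a ≤ coord s e ⊎ coord s f ≤ coord s a
        a-outside = separated a (ends⊆ (here refl))
        b-outside : coord s b ≤ coord s e ⊎ coord s f ≤ coord s b
        b-outside = separated b (ends⊆ (there (here refl)))

    breakpoints : Point → List Point
    breakpoints t = s ∷ t ∷ endpoints

    candidates : Point → List Point
    candidates t = breakpoints t ++ cartesianProductWith (midpoint s) (breakpoints t) (breakpoints t)

    -- e and f are the breakpoints nearest to r from below and from above: r is one of them or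
    -- lies in the same arcs as their midpoint.
    representative : ∀ t r → InSeg s t r → ∃ λ w → w ∈ₗ candidates t × InSeg s t w × SameArcs r w
    representative t r r∈st = choose (coord s e ≟ coord s r) (coord s r ≟ coord s f)
      where
      B : List Point
      B = breakpoints t
      ≤r? : ∀ w → Dec (coord s w ≤ coord s r)
      ≤r? w = coord s w ≤? coord s r
      r≤? : ∀ w → Dec (coord s r ≤ coord s w)
      r≤? w = coord s r ≤? coord s w
      e f : Point
      e = argmax (coord s) s (filter ≤r? B)
      f = argmin (coord s) t (filter r≤? B)
      e∈B : e ∈ₗ B
      e∈B = [ (λ e≡s → subst (_∈ₗ B) (sym e≡s) (here refl)) , (proj₁ ∘ ∈-filter⁻ ≤r?) ]′
              (argmax-sel (coord s) s (filter ≤r? B))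
      f∈B : f ∈ₗ B
      f∈B = [ (λ f≡t → subst (_∈ₗ B) (sym f≡t) (there (here refl))) , (proj₁ ∘ ∈-filter⁻ r≤?) ]′
              (argmin-sel (coord s) t (filter r≤? B))
      e≤r : coord s e ≤ coord s r
      e≤r = argmax-all (coord s) (coord-min-self s r) (all-filter ≤r? B)
      r≤f : coord s r ≤ coord s f
      r≤f = argmin-all (coord s) (to (inSeg-from s t r) r∈st) (all-filter r≤? B)
      f≤t : coord s f ≤ coord s t
      f≤t = f[argmin]≤f[⊤] {f = coord s} t (filter r≤? B)
      separated : ∀ w → w ∈ₗ endpoints → coord s w ≤ coord s e ⊎ coord s f ≤ coord s w
      separated w w∈E = [ (λ w≤r → inj₁ (All.lookup (f[xs]≤f[argmax] {f = coord s} s _) (∈-filter⁺ ≤r? w∈B w≤r)))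
                        , (λ r≤w → inj₂ (All.lookup (f[argmin]≤f[xs] {f = coord s} t _) (∈-filter⁺ r≤? w∈B r≤w))) ]′
                        (ℚ.≤-total (coord s w) (coord s r))
        where
        w∈B : w ∈ₗ B
        w∈B = there (there w∈E)
      choose : Dec (coord s e ≡ coord s r) → Dec (coord s r ≡ coord s f) →
               ∃ λ w → w ∈ₗ candidates t × InSeg s t w × SameArcs r w
      choose (yes κe≡κr) _ = e , ∈-++⁺ˡ e∈B , subst (InSeg s t) r≡e r∈st , subst (SameArcs r) r≡e sameArcs-refl
        where
        r≡e : r ≡ e
        r≡e = sym (coord-injective s e r κe≡κr)
      choose (no _) (yes κr≡κf) = f , ∈-++⁺ˡ f∈B , subst (InSeg s t) r≡f r∈st , subst (SameArcs r) r≡f sameArcs-refl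
        where
        r≡f : r ≡ f
        r≡f = coord-injective s r f κr≡κf
      choose (no κe≢κr) (no κr≢κf) =
        midpoint s e f , ∈-++⁺ʳ B (∈-cartesianProductWith⁺ (midpoint s) e∈B f∈B) ,
        from (inSeg-from s t (midpoint s e f)) (≤-trans (<⇒≤ (proj₂ e<m<f)) f≤t) ,
        breakpoint-gap-sameArcs separated e<r r<f (proj₁ e<m<f) (proj₂ e<m<f)
        where
        e<r : coord s e < coord s r
        e<r = ≤∧≢⇒< e≤r κe≢κr
        r<f : coord s r < coord s f
        r<f = ≤∧≢⇒< r≤f κr≢κf
        e<m<f : coord s e < coord s (midpoint s e f) × coord s (midpoint s e f) < coord s f
        e<m<f = midpoint-between s (<-trans e<r r<f)

  search : (P : Point → Set) → (∀ x → Dec (P x)) → (∀ {x y} → SameArcs x y → P x → P y) →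
           ∀ s t → Dec (∃ λ r → InSeg s t r × P r)
  search P P? P-resp s t = map′ satisfied candidate-witness (any? (λ w → ∈A? w (seg s t) ×-dec P? w) (candidates s t))
    where
    candidate-witness : (∃ λ r → InSeg s t r × P r) → Any (λ w → InSeg s t w × P w) (candidates s t)
    candidate-witness (r , r∈st , Pr) =
      let w , w∈C , w∈st , r~w = representative s t r r∈st in lose w∈C (w∈st , P-resp r~w Pr)

-- Regions and gaps
module _ {n} (V' : Subset n) (R' : Fin n → Arc) where
  open Arcs V' R'

  reg-respects : ∀ {X x y} → SameArcs x y → Reg V' R' X x → Reg V' R' X y
  reg-respects x~y (x∈Reg⁺ , x∉Reg⁻) =
    (λ v v∈X v∈V' → to (x~y v v∈V') (x∈Reg⁺ v v∈X v∈V')) ,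
    (λ (u , u∈V' , u∉Pre , y∈u) → x∉Reg⁻ (u , u∈V' , u∉Pre , from (x~y u u∈V') y∈u))

  -- An arc containing x but not y would not be in Pre(X), so it would put x in Reg⁻(X).
  reg-spread : ∀ {X x y} → Reg V' R' X x → Reg V' R' X y → ∀ u → u ∈ V' → x ∈A R' u → y ∈A R' u
  reg-spread {X} {x} {y} x∈X y∈X u u∈V' x∈u with ∈A? y (R' u)
  ... | yes y∈u = y∈u
  ... | no  y∉u = ⊥-elim (proj₂ x∈X (u , u∈V' , u∉Pre , x∈u))
    where
    u∉Pre : ¬ InPre V' R' X (R' u)
    u∉Pre (v , v∈X , v∈V' , u≈v) = y∉u (proj₂ (u≈v y) (proj₁ y∈X v v∈X v∈V'))

  reg-sameArcs : ∀ {X x y} → Reg V' R' X x → Reg V' R' X y → SameArcs x y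
  reg-sameArcs x∈X y∈X u u∈V' = mk⇔ (reg-spread x∈X y∈X u u∈V') (reg-spread y∈X x∈X u u∈V')

  reg? : ∀ {X c} → Reg V' R' X c → ∀ x → Dec (Reg V' R' X x)
  reg? {c = c} c∈X x with sameArcs? c x
  ... | yes c~x = yes (reg-respects c~x c∈X)
  ... | no  c≁x = no (c≁x ∘ reg-sameArcs c∈X)

module Gap {n} (V' : Subset n) (R' : Fin n → Arc) {D : Subset n} {d : Point} (d∈D : Reg V' R' D d)
           {J : PSet} (J-gap : ComponentOf J (λ p → ¬ Reg V' R' D p)) where
  open Arcs V' R'

  private
    RegD : PSet
    RegD = Reg V' R' D

    J⊆¬RegD : J ⊆ₚ (λ p → ¬ RegD p)
    J⊆¬RegD = proj₁ (proj₂ J-gap)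

    p₀ : Point
    p₀ = proj₁ (proj₁ J-gap)

    Jp₀ : J p₀
    Jp₀ = proj₂ (proj₁ J-gap)

  J-connected : Connected J
  J-connected = proj₁ (proj₂ (proj₂ J-gap))

  d∉J : ¬ J d
  d∉J Jd = J⊆¬RegD d Jd d∈D

  MeetsRegD : Point → Point → Set
  MeetsRegD s t = ∃ λ r → InSeg s t r × RegD r

  meetsRegD? : ∀ s t → Dec (MeetsRegD s t)
  meetsRegD? = search RegD (reg? V' R' d∈D) (reg-respects V' R')

  absorb : ∀ s t {p} → J p → InSeg s t p → ¬ MeetsRegD s t → ∀ r → InSeg s t r → J r
  absorb s t Jp p∈st avoids =
    component-absorbs J-gap (arc-connected (seg s t)) (λ r r∈st r∈D → avoids (r , r∈st , r∈D)) Jp p∈st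

  gap? : ∀ x → Dec (J x)
  gap? x = decide (meetsRegD? p₀ x) (meetsRegD? x p₀)
    where
    decide : Dec (MeetsRegD p₀ x) → Dec (MeetsRegD x p₀) → Dec (J x)
    decide (no  avoids) _            = yes (absorb p₀ x Jp₀ (seg-start p₀ x) avoids x (seg-end p₀ x))
    decide (yes _)      (no  avoids) = yes (absorb x p₀ Jp₀ (seg-end x p₀) avoids x (seg-start x p₀))
    decide (yes (r₁ , r₁∈p₀x , r₁∈D)) (yes (r₂ , r₂∈xp₀ , r₂∈D)) = no λ Jx →
      [ (λ p₀x⊆J → J⊆¬RegD r₁ (p₀x⊆J r₁ r₁∈p₀x) r₁∈D) , (λ xp₀⊆J → J⊆¬RegD r₂ (xp₀⊆J r₂ r₂∈xp₀) r₂∈D) ]′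
      (J-connected p₀ x Jp₀ Jx)

  region-in-gap : ∀ {X p c} → Reg V' R' X p → Reg V' R' X c → J p → J c
  region-in-gap {X} {p} {c} p∈X c∈X Jp = conclude (meetsRegD? p c) (meetsRegD? c p)
    where
    p∉D : ¬ RegD p
    p∉D = J⊆¬RegD p Jp

    c∉D : ¬ RegD c
    c∉D = p∉D ∘ reg-respects V' R' (reg-sameArcs V' R' c∈X p∈X)

    distinct : ∀ {x y} → RegD x → ¬ RegD y → x ≢ y
    distinct x∈D y∉D x≡y = y∉D (subst RegD x≡y x∈D)

    p∈D : ∀ {d₁ d₂} → InSeg p c d₁ → RegD d₁ → InSeg c p d₂ → RegD d₂ → RegD p
    p∈D {d₁} {d₂} d₁∈pc d₁∈D d₂∈cp d₂∈D = reg-respects V' R' d₁~p d₁∈D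
      where
      order : InSeg d₁ d₂ c × InSeg d₂ d₁ p
      order = interleave d₁∈pc d₂∈cp (distinct d₁∈D c∉D) (distinct d₂∈D c∉D) (distinct d₂∈D p∉D)
      d₁~p : SameArcs d₁ p
      d₁~p u u∈V' = ⇔-sym (interleaved-⇔ (R' u) d₁∈pc d₂∈cp (proj₁ order) (proj₂ order)
                           (reg-sameArcs V' R' p∈X c∈X u u∈V') (reg-sameArcs V' R' d₁∈D d₂∈D u u∈V'))

    conclude : Dec (MeetsRegD p c) → Dec (MeetsRegD c p) → J c
    conclude (no  avoids) _            = absorb p c Jp (seg-start p c) avoids c (seg-end p c)
    conclude (yes _)      (no  avoids) = absorb c p Jp (seg-end c p) avoids c (seg-start c p)
    conclude (yes (_ , d₁∈pc , d₁∈D)) (yes (_ , d₂∈cp , d₂∈D)) =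
      ⊥-elim (p∉D (p∈D d₁∈pc d₁∈D d₂∈cp d₂∈D))

subsets : ∀ n → List (Subset n)
subsets zero    = [] ∷ []
subsets (suc n) = map (true ∷_) (subsets n) ++ map (false ∷_) (subsets n)

subsets-complete : ∀ {n} (X : Subset n) → X ∈ₗ subsets n
subsets-complete []          = here refl
subsets-complete (true ∷ X)  = ∈-++⁺ˡ (∈-map⁺ (true ∷_) (subsets-complete X))
subsets-complete {suc n} (false ∷ X) =
  ∈-++⁺ʳ (map (true ∷_) (subsets n)) (∈-map⁺ (false ∷_) (subsets-complete X))

lemma10 : ∀ {n} (G : Graph n) (V' : Subset n) (R' R : Fin n → Arc)
          (cp : Subset n → Point) (D : Subset n) (J : PSet) →
          IsNHCARep G V' R' → IsNHCARep G ⊤ R → Extends V' R' R →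
          IsCliquePoints G V' R' R cp → IsMaxClique G D →
          ComponentOf J (λ p → ¬ Reg V' R' D p) →
          Consecutive G cp (InSJ G V' R' J)
lemma10 {n} G V' R' R cp D J _ _ _ (_ , cp∈Reg , _) D-max J-gap =
  Sum.map (λ none C C-max → none (cp C) (listed C) ∘ to (inSJ⇔ C C-max))
          (λ (a , b , J∩L⊆ab , ab⊆J) → inj₂ (a , b , λ C C-max →
             J∩L⊆ab (cp C) (listed C) ∘ to (inSJ⇔ C C-max) , from (inSJ⇔ C C-max) ∘ ab⊆J (cp C)))
          (connected-hull gap? J-connected d∉J (map cp (subsets n)))
  where
  open Gap V' R' (cp∈Reg D D-max) J-gap

  listed : ∀ C → cp C ∈ₗ map cp (subsets n)
  listed C = ∈-map⁺ cp (subsets-complete C)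

  inSJ⇔ : ∀ C → IsMaxClique G C → InSJ G V' R' J C ⇔ J (cp C)
  inSJ⇔ C C-max = mk⇔ (λ (_ , p , p∈C , Jp) → region-in-gap p∈C (cp∈Reg C C-max) Jp)
                      (λ Jcp → C-max , cp C , cp∈Reg C C-max , Jcp)
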